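{- Let $X$ be a finite set of variables, $\preceq$ a monomial ordering, and $Z,P \subseteq \mathbb{Q}[X]$ finite sets such that the pair $\langle Z,P\rangle$ is reduced with respect to $\preceq$. Then for every polynomial $p \in \mathbb{Q}[X]$, $p \in \mathrm{alg.cone}(Z,P)$ if and only if $\mathbf{red}_Z(p) \in \mathrm{cone}(P)$.
   Context: $\mathrm{cone}(P) = \{\lambda_1 p_1 + \dots + \lambda_n p_n : n\in\mathbb{N}, \lambda_i \in \mathbb{Q}^{\ge 0}, p_i \in P\}$, and $\mathrm{alg.cone}(Z,P) = \langle Z\rangle + \mathrm{cone}(P)$ where $\langle Z \rangle$ is the ideal of $\mathbb{Q}[X]$ generated by $Z$. For a Gröbner basis $G$ (w.r.t. $\preceq$), $\mathbf{red}_G(p)$ is the normal form of $p$ modulo $G$: the unique $q$ with $p-q \in \langle G\rangle$ and no monomial of $q$ divisible by the leading monomial of any $g\in G$. The pair $\langle Z,P\rangle$ is reduced w.r.t. $\preceq$ if $Z$ is a Gröbner basis of $\langle Z\rangle$ w.r.t. $\preceq$ and $\mathbf{red}_Z(p) = p$ for every $p \in P$. -}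

module Defs where

open import Level using (0ℓ)
open import Data.Nat as ℕ using (ℕ)
import Data.Nat.Properties as ℕP
open import Data.Rational as ℚ using (ℚ; 0ℚ; 1ℚ; -_)
open import Data.Vec using (Vec; zipWith; replicate)
open import Data.Vec.Properties using (≡-dec)
open import Data.List using (List; []; _∷_; _++_; map; concat; concatMap)
open import Data.List.Relation.Unary.All using (All)
open import Data.List.Membership.Propositional using (_∈_)
open import Data.Product using (_×_; _,_; proj₁; proj₂; ∃; ∃₂; Σ)
open import Relation.Binary.PropositionalEquality using (_≡_; _≢_)
open import Relation.Binary.Structures using (IsTotalOrder)
open import Relation.Nullary using (¬_; yes; no)
open import Induction.WellFounded using (WellFounded)

Mon : ℕ → Set
Mon n = Vec ℕ n

_·ᵐ_ : ∀ {n} → Mon n → Mon n → Mon n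
_·ᵐ_ = zipWith ℕ._+_

oneᵐ : ∀ {n} → Mon n
oneᵐ = replicate _ 0

_∣ᵐ_ : ∀ {n} → Mon n → Mon n → Set
a ∣ᵐ b = ∃ λ d → b ≡ (a ·ᵐ d)

record MonomialOrder (n : ℕ) : Set₁ where
  field
    _≼_ : Mon n → Mon n → Set
    isTotalOrder : IsTotalOrder _≡_ _≼_
    compatible : ∀ a b c → a ≼ b → (a ·ᵐ c) ≼ (b ·ᵐ c)
    wellOrder : WellFounded (λ a b → a ≼ b × a ≢ b)

-- Polynomials in ℚ[X₁..Xₙ], represented as formal sums of terms c·m.
-- Equality of polynomials is extensional equality of coefficients (_≈_).
Poly : ℕ → Set
Poly n = List (ℚ × Mon n)

coeff : ∀ {n} → Poly n → Mon n → ℚ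
coeff [] m = 0ℚ
coeff ((c , m') ∷ p) m with ≡-dec ℕP._≟_ m' m
... | yes _ = c ℚ.+ coeff p m
... | no  _ = coeff p m

infix 4 _≈_
_≈_ : ∀ {n} → Poly n → Poly n → Set
p ≈ q = ∀ m → coeff p m ≡ coeff q m

_occursIn_ : ∀ {n} → Mon n → Poly n → Set
m occursIn q = coeff q m ≢ 0ℚ

_⊕_ : ∀ {n} → Poly n → Poly n → Poly n
p ⊕ q = p ++ q

scale : ∀ {n} → ℚ → Poly n → Poly n
scale c = map (λ t → (c ℚ.* proj₁ t , proj₂ t))

_⊖_ : ∀ {n} → Poly n → Poly n → Poly n
p ⊖ q = p ⊕ scale (- 1ℚ) q

_⊗_ : ∀ {n} → Poly n → Poly n → Poly n
p ⊗ q = concatMap (λ t → map (λ s → (proj₁ t ℚ.* proj₁ s , proj₂ t ·ᵐ proj₂ s)) q) p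

InIdeal : ∀ {n} → List (Poly n) → Poly n → Set
InIdeal {n} Z f = ∃ λ (hs : List (Poly n × Poly n)) →
  All (λ hz → proj₂ hz ∈ Z) hs × f ≈ concat (map (λ hz → proj₁ hz ⊗ proj₂ hz) hs)

InCone : ∀ {n} → List (Poly n) → Poly n → Set
InCone {n} P f = ∃ λ (ls : List (ℚ × Poly n)) →
  All (λ lq → (0ℚ ℚ.≤ proj₁ lq) × (proj₂ lq ∈ P)) ls
  × f ≈ concat (map (λ lq → scale (proj₁ lq) (proj₂ lq)) ls)

InAlgCone : ∀ {n} → List (Poly n) → List (Poly n) → Poly n → Set
InAlgCone Z P f = ∃₂ λ z c → InIdeal Z z × InCone P c × f ≈ (z ⊕ c)

module _ {n : ℕ} (O : MonomialOrder n) where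
  open MonomialOrder O

  IsLM : Poly n → Mon n → Set
  IsLM g m = m occursIn g × (∀ m' → m' occursIn g → m' ≼ m)

  IsGroebner : List (Poly n) → Set
  IsGroebner Z = ∀ f m → InIdeal Z f → IsLM f m →
    ∃ λ g → g ∈ Z × ∃ λ mg → IsLM g mg × mg ∣ᵐ m

  IsNormalForm : List (Poly n) → Poly n → Poly n → Set
  IsNormalForm Z p q = InIdeal Z (p ⊖ q) ×
    (∀ m → m occursIn q → ∀ g → g ∈ Z → ∀ mg → IsLM g mg → ¬ (mg ∣ᵐ m))

  Reduced : List (Poly n) → List (Poly n) → Set
  Reduced Z P = IsGroebner Z × All (λ p → IsNormalForm Z p p) P

{-# OPTIONS --safe #-}
-- If p = z + c with z ∈ ⟨Z⟩ and c ∈ cone(P), then c − q = (p − q) − z lies in ⟨Z⟩.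
-- Every monomial of c − q occurs in q or in some element of P, so none is divisible by
-- a leading monomial of an element of Z; since Z is a Gröbner basis, c − q must be 0.
-- Conversely p = (p − q) + q.
module Submission where

open import Level using (0ℓ)
open import Function.Base using (id)
open import Function.Bundles using (_⇔_; mk⇔)
open import Data.Nat using (ℕ)
import Data.Nat.Properties as ℕP
open import Data.Product using (_×_; _,_; proj₁; proj₂; ∃; uncurry)
open import Data.Sum using (_⊎_; inj₁; inj₂)
open import Data.Rational as ℚ using (ℚ; 0ℚ; 1ℚ; -_; _+_; _-_; _*_)
open import Data.Rational.Properties
  using (+-identityˡ; +-assoc; *-assoc; *-zeroʳ; *-distribˡ-+; +-*-ring; +-0-group)
open import Data.Rational.Solver using (module +-*-Solver)
open import Algebra.Properties.Ring +-*-ring using (-1*x≈-x)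
open import Algebra.Properties.Group +-0-group using (x∙y⁻¹≈ε⇒x≈y)
open import Data.Vec.Properties using (≡-dec)
open import Data.List using (List; []; _∷_; _++_; map; concat; filter)
open import Data.List.Properties using (map-++; concat-++; map-cong; map-∘)
open import Data.List.Relation.Unary.All as All using (All)
open import Data.List.Relation.Unary.All.Properties using (++⁺; map⁺; all-filter)
open import Data.List.Relation.Unary.Any using (Any; here; there)
open import Data.List.Membership.Propositional using (_∈_; find)
open import Data.List.Membership.Propositional.Properties using (∈-filter⁺)
import Data.List.Extrema as Extrema
open import Relation.Binary.Bundles using (TotalOrder)
open import Relation.Binary.PropositionalEquality
open import Relation.Unary using (Decidable)
open import Relation.Nullary using (¬_; yes; no; ¬?; contradiction)
open import Relation.Nullary.Decidable using (decidable-stable)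

open import Defs

module _ {n : ℕ} where

  coeff-⊕ : ∀ (p q : Poly n) m → coeff (p ⊕ q) m ≡ coeff p m + coeff q m
  coeff-⊕ [] q m = sym (+-identityˡ (coeff q m))
  coeff-⊕ ((c , m′) ∷ p) q m with ≡-dec ℕP._≟_ m′ m
  ... | yes _ = trans (cong (c +_) (coeff-⊕ p q m)) (sym (+-assoc c (coeff p m) (coeff q m)))
  ... | no _  = coeff-⊕ p q m

  coeff-scale : ∀ a (p : Poly n) m → coeff (scale a p) m ≡ a * coeff p m
  coeff-scale a [] m = sym (*-zeroʳ a)
  coeff-scale a ((c , m′) ∷ p) m with ≡-dec ℕP._≟_ m′ m
  ... | yes _ = trans (cong (a * c +_) (coeff-scale a p m)) (sym (*-distribˡ-+ a c (coeff p m)))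
  ... | no _  = coeff-scale a p m

  coeff-⊖ : ∀ (p q : Poly n) m → coeff (p ⊖ q) m ≡ coeff p m - coeff q m
  coeff-⊖ p q m = trans (coeff-⊕ p (scale (- 1ℚ) q) m)
    (cong (coeff p m +_) (trans (coeff-scale (- 1ℚ) q m) (-1*x≈-x (coeff q m))))

  ≡⇒≈ : ∀ {p q : Poly n} → p ≡ q → p ≈ q
  ≡⇒≈ p≡q m = cong (λ r → coeff r m) p≡q

  ⊕-cong : ∀ {p p′ q q′ : Poly n} → p ≈ p′ → q ≈ q′ → p ⊕ q ≈ p′ ⊕ q′
  ⊕-cong {p} {p′} {q} {q′} p≈p′ q≈q′ m =
    trans (coeff-⊕ p q m) (trans (cong₂ _+_ (p≈p′ m) (q≈q′ m)) (sym (coeff-⊕ p′ q′ m)))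

  scale-cong : ∀ a {p q : Poly n} → p ≈ q → scale a p ≈ scale a q
  scale-cong a {p} {q} p≈q m =
    trans (coeff-scale a p m) (trans (cong (a *_) (p≈q m)) (sym (coeff-scale a q m)))

  p≈p⊖q⊕q : ∀ (p q : Poly n) → p ≈ (p ⊖ q) ⊕ q
  p≈p⊖q⊕q p q m = sym (begin
    coeff ((p ⊖ q) ⊕ q) m               ≡⟨ coeff-⊕ (p ⊖ q) q m ⟩
    coeff (p ⊖ q) m + coeff q m         ≡⟨ cong (_+ coeff q m) (coeff-⊖ p q m) ⟩
    (coeff p m - coeff q m) + coeff q m ≡⟨ solve 2 (λ x y → (x :- y) :+ y := x) refl
                                             (coeff p m) (coeff q m) ⟩
    coeff p m                           ∎)
    where
    open ≡-Reasoning
    open +-*-Solver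

  p⊖q⊖z≈c⊖q : ∀ (p q z c : Poly n) → p ≈ z ⊕ c → (p ⊖ q) ⊖ z ≈ c ⊖ q
  p⊖q⊖z≈c⊖q p q z c p≈z⊕c m = begin
    coeff ((p ⊖ q) ⊖ z) m                             ≡⟨ coeff-⊖ (p ⊖ q) z m ⟩
    coeff (p ⊖ q) m - coeff z m                       ≡⟨ cong (_- coeff z m) (coeff-⊖ p q m) ⟩
    (coeff p m - coeff q m) - coeff z m               ≡⟨ cong (λ x → (x - coeff q m) - coeff z m)
                                                           (trans (p≈z⊕c m) (coeff-⊕ z c m)) ⟩
    ((coeff z m + coeff c m) - coeff q m) - coeff z m ≡⟨ solve 3 (λ x y w → ((x :+ y) :- w) :- x := y :- w)
                                                           refl (coeff z m) (coeff c m) (coeff q m) ⟩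
    coeff c m - coeff q m                             ≡⟨ coeff-⊖ c q m ⟨
    coeff (c ⊖ q) m                                   ∎
    where
    open ≡-Reasoning
    open +-*-Solver

  ⊖≈[]⇒≈ : ∀ {p q : Poly n} → p ⊖ q ≈ [] → p ≈ q
  ⊖≈[]⇒≈ {p} {q} p⊖q≈0 m =
    x∙y⁻¹≈ε⇒x≈y (coeff p m) (coeff q m) (trans (sym (coeff-⊖ p q m)) (p⊖q≈0 m))

  occurs-⊖ : ∀ (p q : Poly n) {m} → m occursIn (p ⊖ q) → m occursIn p ⊎ m occursIn q
  occurs-⊖ p q {m} occ with coeff p m ℚ.≟ 0ℚ | coeff q m ℚ.≟ 0ℚ
  ... | no p≢0  | _       = inj₁ p≢0
  ... | yes _   | no q≢0  = inj₂ q≢0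
  ... | yes p≡0 | yes q≡0 = contradiction (trans (coeff-⊖ p q m) (cong₂ _-_ p≡0 q≡0)) occ

  occurs⇒∈monomials : ∀ (p : Poly n) {m} → m occursIn p → m ∈ map proj₂ p
  occurs⇒∈monomials [] occ = contradiction refl occ
  occurs⇒∈monomials ((c , m′) ∷ p) {m} occ with ≡-dec ℕP._≟_ m′ m
  ... | yes m′≡m = here (sym m′≡m)
  ... | no _     = there (occurs⇒∈monomials p occ)

  combination : List (Poly n × Poly n) → Poly n
  combination hs = concat (map (uncurry _⊗_) hs)

  combination-++ : ∀ hs ks → combination (hs ++ ks) ≡ combination hs ⊕ combination ks
  combination-++ hs ks =
    trans (cong concat (map-++ (uncurry _⊗_) hs ks))
          (sym (concat-++ (map (uncurry _⊗_) hs) (map (uncurry _⊗_) ks)))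

  scale-⊗ : ∀ a (h z : Poly n) → scale a h ⊗ z ≡ scale a (h ⊗ z)
  scale-⊗ a [] z = refl
  scale-⊗ a ((c , t) ∷ h) z = trans
    (cong₂ _++_ (trans (map-cong (λ s → cong (_, t ·ᵐ proj₂ s) (*-assoc a c (proj₁ s))) z)
                       (map-∘ z))
                (scale-⊗ a h z))
    (sym (map-++ _ (map _ z) (h ⊗ z)))

  combination-scale : ∀ a hs →
    combination (map (λ hz → (scale a (proj₁ hz) , proj₂ hz)) hs) ≡ scale a (combination hs)
  combination-scale a [] = refl
  combination-scale a ((h , z) ∷ hs) =
    trans (cong₂ _++_ (scale-⊗ a h z) (combination-scale a hs))
          (sym (map-++ _ (h ⊗ z) (combination hs)))

  module _ {Z : List (Poly n)} where

    InIdeal-resp-≈ : ∀ {f g : Poly n} → f ≈ g → InIdeal Z f → InIdeal Z g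
    InIdeal-resp-≈ f≈g (hs , hs∈Z , f≈hs) = hs , hs∈Z , λ m → trans (sym (f≈g m)) (f≈hs m)

    InIdeal-⊕ : ∀ {f g : Poly n} → InIdeal Z f → InIdeal Z g → InIdeal Z (f ⊕ g)
    InIdeal-⊕ {f} {g} (hs , hs∈Z , f≈hs) (ks , ks∈Z , g≈ks) =
      hs ++ ks , ++⁺ hs∈Z ks∈Z , λ m →
        trans (⊕-cong {f} {combination hs} {g} {combination ks} f≈hs g≈ks m)
              (≡⇒≈ (sym (combination-++ hs ks)) m)

    InIdeal-scale : ∀ a {f : Poly n} → InIdeal Z f → InIdeal Z (scale a f)
    InIdeal-scale a {f} (hs , hs∈Z , f≈hs) = _ , map⁺ hs∈Z , λ m →
      trans (scale-cong a {f} {combination hs} f≈hs m) (≡⇒≈ (sym (combination-scale a hs)) m)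

    InIdeal-⊖ : ∀ {f g : Poly n} → InIdeal Z f → InIdeal Z g → InIdeal Z (f ⊖ g)
    InIdeal-⊖ {f} {g} f∈Z g∈Z =
      InIdeal-⊕ {f} {scale (- 1ℚ) g} f∈Z (InIdeal-scale (- 1ℚ) {g} g∈Z)

  conic : List (ℚ × Poly n) → Poly n
  conic ls = concat (map (λ lq → scale (proj₁ lq) (proj₂ lq)) ls)

  occurs-conic : ∀ ls {m} → m occursIn conic ls → Any (λ lq → m occursIn proj₂ lq) ls
  occurs-conic [] occ = contradiction refl occ
  occurs-conic ((l , p) ∷ ls) {m} occ with coeff p m ℚ.≟ 0ℚ
  ... | no p≢0 = here p≢0
  ... | yes p≡0 = there (occurs-conic ls λ rest≡0 → occ (begin
    coeff (scale l p ⊕ conic ls) m           ≡⟨ coeff-⊕ (scale l p) (conic ls) m ⟩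
    coeff (scale l p) m + coeff (conic ls) m ≡⟨ cong₂ _+_ (coeff-scale l p m) rest≡0 ⟩
    l * coeff p m + 0ℚ                       ≡⟨ cong (λ x → l * x + 0ℚ) p≡0 ⟩
    l * 0ℚ + 0ℚ                              ≡⟨ cong (_+ 0ℚ) (*-zeroʳ l) ⟩
    0ℚ                                       ∎))
    where
    open ≡-Reasoning

  InCone-resp-≈ : ∀ {P : List (Poly n)} {f g : Poly n} → f ≈ g → InCone P f → InCone P g
  InCone-resp-≈ f≈g (ls , ls∈P , f≈ls) = ls , ls∈P , λ m → trans (sym (f≈g m)) (f≈ls m)

module _ {n : ℕ} (O : MonomialOrder n) where
  open MonomialOrder O

  Irreducible : List (Poly n) → Poly n → Set
  Irreducible Z q = ∀ m → m occursIn q → ∀ g → g ∈ Z → ∀ mg → IsLM O g mg → ¬ (mg ∣ᵐ m)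

  module _ {Z : List (Poly n)} where

    Irreducible-resp-≈ : ∀ {p q : Poly n} → p ≈ q → Irreducible Z p → Irreducible Z q
    Irreducible-resp-≈ p≈q irr m occ = irr m (λ p≡0 → occ (trans (sym (p≈q m)) p≡0))

    Irreducible-⊖ : ∀ (p q : Poly n) → Irreducible Z p → Irreducible Z q → Irreducible Z (p ⊖ q)
    Irreducible-⊖ p q irr-p irr-q m occ with occurs-⊖ p q occ
    ... | inj₁ occ-p = irr-p m occ-p
    ... | inj₂ occ-q = irr-q m occ-q

    Irreducible-cone : ∀ {P : List (Poly n)} {c : Poly n} →
      All (Irreducible Z) P → InCone P c → Irreducible Z c
    Irreducible-cone {c = c} irr-P (ls , ls∈P , c≈ls) =
      Irreducible-resp-≈ {conic ls} {c} (λ m → sym (c≈ls m)) irr-ls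
      where
      irr-ls : Irreducible Z (conic ls)
      irr-ls m occ with find (occurs-conic ls occ)
      ... | (_ , p) , lq∈ls , occ-p = All.lookup irr-P (proj₂ (All.lookup ls∈P lq∈ls)) m occ-p

  ≼-totalOrder : TotalOrder 0ℓ 0ℓ 0ℓ
  ≼-totalOrder = record { isTotalOrder = isTotalOrder }

  ∃-IsLM : ∀ (f : Poly n) {m} → m occursIn f → ∃ (IsLM O f)
  ∃-IsLM f {m} occ = M , argmax-all id occ (all-filter occurs? (map proj₂ f)) , ≼M
    where
    open Extrema ≼-totalOrder using (max; argmax-all; xs≤max)

    occurs? : Decidable (_occursIn f)
    occurs? m = ¬? (coeff f m ℚ.≟ 0ℚ)

    M : Mon n
    M = max m (filter occurs? (map proj₂ f))

    ≼M : ∀ m′ → m′ occursIn f → m′ ≼ M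
    ≼M m′ occ′ =
      All.lookup (xs≤max m _) (∈-filter⁺ occurs? (occurs⇒∈monomials f occ′) occ′)

  groebner-irreducible≈0 : ∀ {Z : List (Poly n)} {f : Poly n} →
    IsGroebner O Z → InIdeal Z f → Irreducible Z f → f ≈ []
  groebner-irreducible≈0 {f = f} groebner f∈Z irr m =
    decidable-stable (coeff f m ℚ.≟ 0ℚ) λ occ →
    let M , lm = ∃-IsLM f occ
        g , g∈Z , mg , lm-g , mg∣M = groebner f M f∈Z lm
    in irr M (proj₁ lm) g g∈Z mg lm-g mg∣M

lemma3p3 : ∀ {n : ℕ} (O : MonomialOrder n) (Z P : List (Poly n)) →
    Reduced O Z P →
    ∀ (p q : Poly n) → IsNormalForm O Z p q →
    (InAlgCone Z P p ⇔ InCone P q)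
lemma3p3 O Z P (groebner , P-reduced) p q (p⊖q∈Z , q-irr) = mk⇔ to from
  where
  from : InCone P q → InAlgCone Z P p
  from q∈cone = p ⊖ q , q , p⊖q∈Z , q∈cone , p≈p⊖q⊕q p q

  to : InAlgCone Z P p → InCone P q
  to (z , c , z∈Z , c∈cone , p≈z⊕c) = InCone-resp-≈ {f = c} {g = q} c≈q c∈cone
    where
    c⊖q∈Z : InIdeal Z (c ⊖ q)
    c⊖q∈Z = InIdeal-resp-≈ {f = (p ⊖ q) ⊖ z} {g = c ⊖ q} (p⊖q⊖z≈c⊖q p q z c p≈z⊕c)
              (InIdeal-⊖ {f = p ⊖ q} {g = z} p⊖q∈Z z∈Z)

    c-irr : Irreducible O Z c
    c-irr = Irreducible-cone O {c = c} (All.map proj₂ P-reduced) c∈cone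

    c≈q : c ≈ q
    c≈q = ⊖≈[]⇒≈ {p = c} {q = q}
            (groebner-irreducible≈0 O {f = c ⊖ q} groebner c⊖q∈Z (Irreducible-⊖ O c q c-irr q-irr))
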